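{- Let $C=(V,\lambda)$ be a temporal clique. Then there is a temporal bi-clique $D=(A,B,\lambda')$ with $|V|=|A|=|B|$ such that for any bi-spanner $S_D$ of $D$ there is a spanner $S_C$ of $C$ with $|S_C|\le|S_D|$.
   Context: A temporal graph is $(V,E,\lambda)$ with $\lambda\colon E\to\mathbb{N}$. A path $v_1\dots v_k$ is temporal if $\lambda(\{v_i,v_{i+1}\})\le\lambda(\{v_{i+1},v_{i+2}\})$ for all $i\in[k-2]$. A temporal clique $(V,\lambda)$ has the complete graph on $V$ as underlying graph. A spanner of a temporal graph is an edge set $S$ such that every vertex reaches every other vertex by a temporal path using only edges of $S$. A temporal bi-clique $(A,B,\lambda)$ has the complete bipartite graph with disjoint parts $A,B$ as underlying graph; a bi-spanner is an edge set $S$ such that every $a\in A$ reaches every $b\in B$ via a temporal path within $S$. -}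

module Defs where

open import Data.Nat using (ℕ; _≤_; _<_)
open import Data.Fin using (Fin; toℕ)
open import Data.Product using (_×_; _,_; Σ; Σ-syntax)
open import Data.Empty using (⊥)
open import Data.Sum using (_⊎_; inj₁; inj₂)
open import Data.List using (List; []; _∷_; _∷ʳ_; map; length)
open import Data.List.Relation.Unary.Unique.Propositional using (Unique)
open import Data.List.Relation.Unary.Linked using (Linked)
open import Data.List.Relation.Unary.All using (All)
open import Data.List.Membership.Propositional using (_∈_)
open import Relation.Binary.PropositionalEquality using (_≡_; _≢_)

steps : {V : Set} → List V → List (V × V)
steps []           = []
steps (x ∷ [])     = []
steps (x ∷ y ∷ xs) = (x , y) ∷ steps (y ∷ xs)

record TemporalPath {V : Set} (E : V → V → Set) (lab : V → V → ℕ) (u v : V) : Set where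
  field
    inner    : List V
  path : List V
  path = u ∷ (inner ∷ʳ v)
  field
    distinct : Unique path
    edges    : Linked E path
    monotone : Linked _≤_ (map (λ e → lab (Data.Product.proj₁ e) (Data.Product.proj₂ e)) (steps path))

-- Temporal cliques on vertex set Fin n.
-- λ : Fin n → Fin n → ℕ gives the label of edge {u,v} (required symmetric;
-- diagonal values are irrelevant).

SymLabel : (n : ℕ) → (Fin n → Fin n → ℕ) → Set
SymLabel n λc = ∀ u v → λc u v ≡ λc v u

CliqueEdgeSet : ℕ → Set
CliqueEdgeSet n = Σ[ S ∈ List (Fin n × Fin n) ]
  (Unique S × All (λ e → toℕ (Data.Product.proj₁ e) < toℕ (Data.Product.proj₂ e)) S)

cliqueSize : {n : ℕ} → CliqueEdgeSet n → ℕ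
cliqueSize (S , _) = length S

InClique : {n : ℕ} → CliqueEdgeSet n → Fin n → Fin n → Set
InClique (S , _) x y = ((x , y) ∈ S) ⊎ ((y , x) ∈ S)

IsSpanner : (n : ℕ) → (Fin n → Fin n → ℕ) → CliqueEdgeSet n → Set
IsSpanner n λc S = ∀ (u v : Fin n) → u ≢ v → TemporalPath (InClique S) λc u v

-- Temporal bi-cliques (A, B, λ') with A = B = Fin n (disjoint copies), i.e.
-- vertex set Fin n ⊎ Fin n; λ' a b = label of edge {a,b}, a ∈ A, b ∈ B.

BiEdgeSet : ℕ → Set
BiEdgeSet n = Σ[ S ∈ List (Fin n × Fin n) ] Unique S

biSize : {n : ℕ} → BiEdgeSet n → ℕ
biSize (S , _) = length S

InBi : {n : ℕ} → BiEdgeSet n → (Fin n ⊎ Fin n) → (Fin n ⊎ Fin n) → Set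
InBi (S , _) (inj₁ a) (inj₂ b) = (a , b) ∈ S
InBi (S , _) (inj₂ b) (inj₁ a) = (a , b) ∈ S
InBi (S , _) (inj₁ _) (inj₁ _) = ⊥
InBi (S , _) (inj₂ _) (inj₂ _) = ⊥

biLab : {n : ℕ} → (Fin n → Fin n → ℕ) → (Fin n ⊎ Fin n) → (Fin n ⊎ Fin n) → ℕ
biLab λb (inj₁ a) (inj₂ b) = λb a b
biLab λb (inj₂ b) (inj₁ a) = λb a b
biLab λb (inj₁ _) (inj₁ _) = 0
biLab λb (inj₂ _) (inj₂ _) = 0

IsBiSpanner : (n : ℕ) → (Fin n → Fin n → ℕ) → BiEdgeSet n → Set
IsBiSpanner n λb S = ∀ (a b : Fin n) → TemporalPath (InBi S) (biLab λb) (inj₁ a) (inj₂ b)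

-- Take λ′ = λ on the bi-clique with A and B two copies of V. Forgetting the side of a
-- vertex maps every edge of a bi-spanner S_D either to a clique edge with the same label or,
-- for the edges {a, a}, to a single vertex; let S_C be the image, of size at most |S_D|.
-- A temporal path from a ∈ A to b ∈ B in S_D then becomes a temporal walk from a to b in
-- S_C, and cutting out the cycles of a temporal walk leaves a temporal path.
module Submission where

open import Defs
open import Data.Nat using (ℕ; _≤_; z≤n)
open import Data.Nat.Properties using (≤-refl; ≤-trans)
open import Data.Fin using (Fin; _<_)
open import Data.Fin.Properties using (_≟_; <-cmp)
open import Data.Product using (Σ-syntax; _×_; _,_; proj₁; proj₂; uncurry)
open import Data.Product.Properties using (≡-dec)
open import Data.Sum using (_⊎_; inj₁; inj₂; reduce; swap)
open import Data.Maybe using (Maybe; just; nothing; fromMaybe)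
import Data.Maybe.Relation.Unary.All as Maybe
import Data.Maybe.Relation.Unary.Any as Maybe
open import Data.Empty using (⊥-elim)
open import Data.List using (List; []; _∷_; _∷ʳ_; map; head; mapMaybe; deduplicate)
open import Data.List.Properties using (length-mapMaybe; length-deduplicate)
open import Data.List.Relation.Unary.Unique.Propositional using (Unique)
open import Data.List.Relation.Unary.Unique.DecPropositional.Properties using (deduplicate-!)
open import Data.List.Relation.Unary.AllPairs using ([]; _∷_)
open import Data.List.Relation.Unary.Linked as Linked using (Linked; [-]; _∷_)
open import Data.List.Relation.Unary.All as All using (All; [])
open import Data.List.Relation.Unary.All.Properties as All using (¬Any⇒All¬)
open import Data.List.Relation.Unary.Any as Any using (here; there)
open import Data.List.Relation.Unary.Any.Properties as Any using ()
open import Data.List.Membership.Propositional using (_∈_)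
open import Data.List.Membership.Propositional.Properties using (∈-deduplicate⁺)
open import Data.List.Membership.DecPropositional using (_∈?_)
open import Relation.Binary.Definitions using (DecidableEquality; tri<; tri≈; tri>)
open import Relation.Binary.PropositionalEquality using (_≡_; _≢_; refl; sym; cong; subst)
open import Relation.Nullary using (yes; no)
open import Function using (id)

data TemporalWalk {V : Set} (E : V → V → Set) (lab : V → V → ℕ) : V → ℕ → V → Set where
  done : ∀ {v t} → TemporalWalk E lab v t v
  step : ∀ {x y t v} → E x y → t ≤ lab x y → TemporalWalk E lab y (lab x y) v →
         TemporalWalk E lab x t v

module _ {V : Set} {E : V → V → Set} {lab : V → V → ℕ} where

  Walk : V → ℕ → V → Set
  Walk = TemporalWalk E lab

  labels : List (V × V) → List ℕ
  labels = map (λ e → lab (proj₁ e) (proj₂ e))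

  vertices : ∀ {x t v} → Walk x t v → List V
  vertices {x} done          = x ∷ []
  vertices {x} (step _ _ w) = x ∷ vertices w

  interior : ∀ {x t v} → Walk x t v → List V
  interior done          = []
  interior {x} (step _ _ w) = x ∷ interior w

  vertices≡interior∷ʳend : ∀ {x t v} (w : Walk x t v) → vertices w ≡ interior w ∷ʳ v
  vertices≡interior∷ʳend done          = refl
  vertices≡interior∷ʳend {x} (step _ _ w) = cong (x ∷_) (vertices≡interior∷ʳend w)

  weaken : ∀ {x s t v} → s ≤ t → Walk x t v → Walk x s v
  weaken s≤t done            = done
  weaken s≤t (step e t≤l w) = step e (≤-trans s≤t t≤l) w

  vertices-weaken : ∀ {x s t v} (s≤t : s ≤ t) (w : Walk x t v) →
                    vertices (weaken s≤t w) ≡ vertices w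
  vertices-weaken _ done         = refl
  vertices-weaken _ (step _ _ _) = refl

  fromTemporalPath : ∀ {u v} → TemporalPath E lab u v → Walk u 0 v
  fromTemporalPath {u} {v} p =
    weaken z≤n (go u (TemporalPath.inner p) (TemporalPath.edges p) (TemporalPath.monotone p))
    where
    go : ∀ x xs → Linked E (x ∷ (xs ∷ʳ v)) → Linked _≤_ (labels (steps (x ∷ (xs ∷ʳ v)))) →
         Walk x (lab x (fromMaybe v (head xs))) v
    go x []           (e ∷ [-]) _        = step e ≤-refl done
    go x (y ∷ [])     (e ∷ es)  (l ∷ ls) = step e ≤-refl (weaken l (go y [] es ls))
    go x (y ∷ z ∷ zs) (e ∷ es)  (l ∷ ls) = step e ≤-refl (weaken l (go y (z ∷ zs) es ls))

  suffixFrom : ∀ {x y s v} (w : Walk y s v) → x ∈ vertices w →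
    Σ[ s′ ∈ ℕ ] (s ≤ s′ × Σ[ w′ ∈ Walk x s′ v ] (Unique (vertices w) → Unique (vertices w′)))
  suffixFrom done           (here refl) = _ , ≤-refl , done , id
  suffixFrom (step e l w)   (here refl) = _ , ≤-refl , step e l w , id
  suffixFrom (step _ l w)   (there x∈w) with suffixFrom w x∈w
  ... | s′ , l′ , w′ , unique = s′ , ≤-trans l l′ , w′ , λ { (_ ∷ u) → unique u }

  -- A vertex that recurs is skipped to its later occurrence: labels only increase along the
  -- walk, so the remaining suffix still starts late enough.
  shortcut : DecidableEquality V → ∀ {x t v} → Walk x t v → Σ[ w ∈ Walk x t v ] Unique (vertices w)
  shortcut _≟ᵥ_ done = done , ([] ∷ [])
  shortcut _≟ᵥ_ {x} (step e l w) with shortcut _≟ᵥ_ w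
  ... | w′ , unique-w′ with _∈?_ _≟ᵥ_ x (vertices w′)
  ...   | no  x∉w′ = step e l w′ , (¬Any⇒All¬ _ x∉w′ ∷ unique-w′)
  ...   | yes x∈w′ with suffixFrom w′ x∈w′
  ...     | _ , l′ , w″ , unique =
            weaken (≤-trans l l′) w″ ,
            subst Unique (sym (vertices-weaken (≤-trans l l′) w″)) (unique unique-w′)

  linked-edges : ∀ {x t v} (w : Walk x t v) → Linked E (vertices w)
  linked-edges done                       = [-]
  linked-edges (step e _ done)            = e ∷ [-]
  linked-edges (step e _ w@(step _ _ _)) = e ∷ linked-edges w

  linked-labels : ∀ {x t v} (w : Walk x t v) → Linked _≤_ (t ∷ labels (steps (vertices w)))
  linked-labels done                       = [-]
  linked-labels (step _ l done)            = l ∷ [-]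
  linked-labels (step _ l w@(step _ _ _)) = l ∷ linked-labels w

  toTemporalPath : ∀ {x t v} → x ≢ v → (w : Walk x t v) → Unique (vertices w) →
                   TemporalPath E lab x v
  toTemporalPath x≢v done _ = ⊥-elim (x≢v refl)
  toTemporalPath {x} {v = v} _ w@(step _ _ w′) unique = record
    { inner    = interior w′
    ; distinct = subst Unique path≡ unique
    ; edges    = subst (Linked E) path≡ (linked-edges w)
    ; monotone = subst (λ p → Linked _≤_ (labels (steps p))) path≡ (Linked.tail (linked-labels w))
    }
    where
    path≡ : x ∷ vertices w′ ≡ x ∷ (interior w′ ∷ʳ v)
    path≡ = cong (x ∷_) (vertices≡interior∷ʳend w′)

EdgeContracting : {V W : Set} → (V → V → Set) → (V → V → ℕ) → (W → W → Set) → (W → W → ℕ) →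
                  (V → W) → Set
EdgeContracting E lab E′ lab′ f =
  ∀ {x y} → E x y → f x ≡ f y ⊎ (E′ (f x) (f y) × lab′ (f x) (f y) ≡ lab x y)

mapWalk : ∀ {V W : Set} {E lab E′ lab′} (f : V → W) → EdgeContracting E lab E′ lab′ f →
          ∀ {x t v} → TemporalWalk E lab x t v → TemporalWalk E′ lab′ (f x) t (f v)
mapWalk f contracting done = done
mapWalk {E′ = E′} {lab′ = lab′} f contracting {t = t} {v} (step e l w) with contracting e
... | inj₁ fx≡fy =
      subst (λ z → TemporalWalk E′ lab′ z t (f v)) (sym fx≡fy) (weaken l (mapWalk f contracting w))
... | inj₂ (e′ , lab≡) =
      step e′ (subst (t ≤_) (sym lab≡) l)
              (subst (λ s → TemporalWalk E′ lab′ _ s (f v)) (sym lab≡) (mapWalk f contracting w))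

∈-mapMaybe⁺ : ∀ {A B : Set} (f : A → Maybe B) {x y xs} → x ∈ xs → f x ≡ just y → y ∈ mapMaybe f xs
∈-mapMaybe⁺ f {xs = xs} x∈xs fx≡y =
  Any.mapMaybe⁺ f xs (Any.map⁺ (Any.map (λ { refl → subst (Maybe.Any _) (sym fx≡y) (Maybe.just refl) }) x∈xs))

module _ {n : ℕ} where

  Ordered : Fin n × Fin n → Set
  Ordered (a , b) = a < b

  cliqueEdge : Fin n → Fin n → Maybe (Fin n × Fin n)
  cliqueEdge a b with <-cmp a b
  ... | tri< _ _ _ = just (a , b)
  ... | tri≈ _ _ _ = nothing
  ... | tri> _ _ _ = just (b , a)

  cliqueEdge-ordered : ∀ a b → Maybe.All Ordered (cliqueEdge a b)
  cliqueEdge-ordered a b with <-cmp a b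
  ... | tri< a<b _ _ = Maybe.just a<b
  ... | tri≈ _ _ _   = Maybe.nothing
  ... | tri> _ _ b<a = Maybe.just b<a

  cliqueEdge-nothing : ∀ {a b} → cliqueEdge a b ≡ nothing → a ≡ b
  cliqueEdge-nothing {a} {b} eq with <-cmp a b | eq
  ... | tri≈ _ a≡b _ | _ = a≡b

  cliqueEdge-inClique : ∀ (S : CliqueEdgeSet n) {a b e} → cliqueEdge a b ≡ just e →
                        e ∈ proj₁ S → InClique S a b
  cliqueEdge-inClique S {a} {b} eq e∈S with <-cmp a b | eq
  ... | tri< _ _ _ | refl = inj₁ e∈S
  ... | tri> _ _ _ | refl = inj₂ e∈S

  _≟ₑ_ : DecidableEquality (Fin n × Fin n)
  _≟ₑ_ = ≡-dec _≟_ _≟_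

  cliqueEdges : List (Fin n × Fin n) → List (Fin n × Fin n)
  cliqueEdges S = mapMaybe (uncurry cliqueEdge) S

  collapse : BiEdgeSet n → CliqueEdgeSet n
  collapse (S , _) =
    deduplicate _≟ₑ_ (cliqueEdges S) ,
    deduplicate-! _≟ₑ_ (cliqueEdges S) ,
    All.deduplicate⁺ _≟ₑ_ (All.mapMaybe⁺ (All.map⁺ (All.universal (uncurry cliqueEdge-ordered) S)))

  collapse-size : ∀ S → cliqueSize (collapse S) ≤ biSize S
  collapse-size (S , _) =
    ≤-trans (length-deduplicate _≟ₑ_ (cliqueEdges S)) (length-mapMaybe (uncurry cliqueEdge) S)

  collapse-edge : ∀ S {a b} → (a , b) ∈ proj₁ S → a ≡ b ⊎ InClique (collapse S) a b
  collapse-edge S {a} {b} ab∈S with cliqueEdge a b in eq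
  ... | nothing = inj₁ (cliqueEdge-nothing eq)
  ... | just e  = inj₂ (cliqueEdge-inClique (collapse S) eq
                         (∈-deduplicate⁺ _≟ₑ_ (∈-mapMaybe⁺ (uncurry cliqueEdge) ab∈S eq)))

  reduce-contracting : ∀ {λc} → SymLabel n λc → ∀ S →
                       EdgeContracting (InBi S) (biLab λc) (InClique (collapse S)) λc reduce
  reduce-contracting sym-λc S {inj₁ a} {inj₂ b} ab∈S with collapse-edge S ab∈S
  ... | inj₁ a≡b = inj₁ a≡b
  ... | inj₂ ab∈C = inj₂ (ab∈C , refl)
  reduce-contracting sym-λc S {inj₂ b} {inj₁ a} ab∈S with collapse-edge S ab∈S
  ... | inj₁ a≡b = inj₁ (sym a≡b)
  ... | inj₂ ab∈C = inj₂ (swap ab∈C , sym-λc b a)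

  collapse-spanner : ∀ {λc} → SymLabel n λc → ∀ S → IsBiSpanner n λc S → IsSpanner n λc (collapse S)
  collapse-spanner sym-λc S biSpanner u v u≢v =
    toTemporalPath u≢v (proj₁ path) (proj₂ path)
    where
    path = shortcut _≟_ (mapWalk reduce (reduce-contracting sym-λc S) (fromTemporalPath (biSpanner u v)))

lemma5 : (n : ℕ) (λc : Fin n → Fin n → ℕ) → SymLabel n λc →
    Σ[ λb ∈ (Fin n → Fin n → ℕ) ]
      ((SD : BiEdgeSet n) → IsBiSpanner n λb SD →
        Σ[ SC ∈ CliqueEdgeSet n ] (IsSpanner n λc SC × cliqueSize SC ≤ biSize SD))
lemma5 n λc sym-λc = λc , λ SD biSpanner →
  collapse SD , collapse-spanner sym-λc SD biSpanner , collapse-size SD
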